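{- Let $q=3^r\ge 9$. For every $g\in\mathcal{T}_q$ and $s\in(\mathbb{Z}/q\mathbb{Z})^\times$, $g\circ\theta_s=g$ if and only if $s=1$.
   Context: $\mathcal{T}_q$ is the set of functions $g:(\mathbb{Z}/q\mathbb{Z})^\times\to\{0,1\}$ such that $g(a)+g(-a)=1$ for all $a$, and $g(a)=0$ for every $a$ whose representative in $\{1,\dots,q-1\}$ is less than $q/3$. For $s\in(\mathbb{Z}/q\mathbb{Z})^\times$, $\theta_s$ denotes multiplication by $s$. -}

module Defs where

open import Data.Bool using (Bool; true; false)
open import Data.Nat using (ℕ; _+_; _*_; _∸_; _<_; NonZero)
open import Data.Nat.DivMod using (_%_)
open import Data.Nat.Coprimality using (Coprime)
open import Data.Product using (_×_)
open import Relation.Binary.PropositionalEquality using (_≡_)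

-- Elements of (ℤ/qℤ)ˣ are represented by their canonical
-- representatives a ∈ {0,…,q-1} with gcd(a,q) = 1.
IsUnit : ℕ → ℕ → Set
IsUnit q a = a < q × Coprime a q

negMod : (q : ℕ) → .{{_ : NonZero q}} → ℕ → ℕ
negMod q a = (q ∸ a) % q

θ : (q : ℕ) → .{{_ : NonZero q}} → ℕ → ℕ → ℕ
θ q s a = (s * a) % q

val : Bool → ℕ
val false = 0
val true  = 1

-- g ∈ 𝒯_q : g : (ℤ/qℤ)ˣ → {0,1} with g(a)+g(-a)=1 for all units a and
-- g(a)=0 for every unit a whose representative is < q/3 (i.e. 3a < q).
-- g is given on all residues; only its values on units are constrained/used.
record InT (q : ℕ) .{{_ : NonZero q}} (g : ℕ → Bool) : Set where
  field
    antisym : ∀ a → IsUnit q a → val (g a) + val (g (negMod q a)) ≡ 1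
    small   : ∀ a → IsUnit q a → 3 * a < q → val (g a) ≡ 0

Invariant : (q : ℕ) → .{{_ : NonZero q}} → (ℕ → Bool) → ℕ → Set
Invariant q g s = ∀ a → IsUnit q a → g (θ q s a) ≡ g a

-- If g ∘ θ_s = g then g ∘ θ_{sᵏ} = g for all k.  Since g vanishes on the units below q/3
-- and, by g(a) + g(−a) = 1, equals 1 on the units above 2q/3, no power of s may send a
-- small unit to a large one; we show that every s ≠ 1 has such a power.  As 3 ∤ s, s or s²
-- is 1 + 3a.  Unless q ∣ 3a, write 3a = 3ʲ⁺¹t with 3 ∤ t; since (1 + 3ʲ⁺¹t)^(3ⁱ) = 1 + 3ʲ⁺¹⁺ⁱt′
-- with 3 ∤ t′, some power of s is ≡ 1 + q/3 or 1 + 2q/3 (mod q), sending 2 resp. 1 above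
-- 2q/3.  If q ∣ 3a, then s = 1, or s² ≡ 1 and hence s ≡ −1 (3 divides only one of s ∓ 1),
-- which sends 1 to q − 1.
{-# OPTIONS --safe #-}
module Submission where

open import Defs
open import Data.Bool using (Bool; true; false)
open import Data.Nat
open import Data.Nat.Coprimality as Coprime using (Coprime; coprime-divisor)
open import Data.Nat.Divisibility
open import Data.Nat.DivMod
open import Data.Nat.Induction using (<-wellFounded)
open import Data.Nat.Primality
  using (Prime; prime?; euclidsLemma; prime⇒irreducible; prime⇒nonTrivial)
open import Data.Nat.Properties
open import Data.Nat.Tactic.RingSolver using (solve-∀)
open import Data.Product using (∃; ∃₂; _×_; _,_)
open import Data.Sum using (_⊎_; inj₁; inj₂)
open import Function.Bundles using (_⇔_; mk⇔)
open import Induction.WellFounded using (Acc; acc)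
open import Relation.Nullary using (¬_; yes; no; contradiction)
open import Relation.Nullary.Decidable using (from-yes)
open import Relation.Binary.PropositionalEquality

private
  variable
    a b c d j k n p s t x y : ℕ
    g : ℕ → Bool

∤-* : Prime p → ¬ p ∣ a → ¬ p ∣ b → ¬ p ∣ a * b
∤-* {a = a} {b} pr p∤a p∤b p∣ab with euclidsLemma a b pr p∣ab
... | inj₁ p∣a = p∤a p∣a
... | inj₂ p∣b = p∤b p∣b

∣n⇒∤m+n : ∀ {m} .{{_ : NonZero m}} → m < d → d ∣ n → ¬ d ∣ m + n
∣n⇒∤m+n {d = d} {n = n} {m = m} m<d d∣n d∣m+n =
  <⇒≱ m<d (∣⇒≤ (∣m+n∣m⇒∣n (subst (d ∣_) (+-comm m n) d∣m+n) d∣n))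

^-monoʳ-∣ : ∀ {m} p → m ≤ n → p ^ m ∣ p ^ n
^-monoʳ-∣ {n = n} {m = m} p m≤n = divides (p ^ (n ∸ m)) (begin
  p ^ n                 ≡⟨ cong (p ^_) (m+[n∸m]≡n m≤n) ⟨
  p ^ (m + (n ∸ m))     ≡⟨ ^-distribˡ-+-* p m (n ∸ m) ⟩
  p ^ m * p ^ (n ∸ m)   ≡⟨ *-comm (p ^ m) (p ^ (n ∸ m)) ⟩
  p ^ (n ∸ m) * p ^ m   ∎)
  where open ≡-Reasoning

[m*[n%o]]%o≡[m*n]%o : ∀ m n o .{{_ : NonZero o}} → (m * (n % o)) % o ≡ (m * n) % o
[m*[n%o]]%o≡[m*n]%o m n o = begin
  (m * (n % o)) % o           ≡⟨ %-distribˡ-* m (n % o) o ⟩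
  ((m % o) * (n % o % o)) % o ≡⟨ cong (λ r → ((m % o) * r) % o) (m%n%n≡m%n n o) ⟩
  ((m % o) * (n % o)) % o     ≡⟨ %-distribˡ-* m n o ⟨
  (m * n) % o                 ∎
  where open ≡-Reasoning

2*n<3*[n∸1] : 3 < n → 2 * n < 3 * (n ∸ 1)
2*n<3*[n∸1] {suc n} (s≤s 2<n) = begin-strict
  2 * suc n   ≡⟨ *-suc 2 n ⟩
  2 + 2 * n   <⟨ +-monoˡ-< (2 * n) 2<n ⟩
  3 * n       ∎
  where open ≤-Reasoning

m+m*2≡3*m : ∀ m → m + m * 2 ≡ 3 * m
m+m*2≡3*m = solve-∀

coprime-*ʳ : Coprime a b → Coprime a c → Coprime a (b * c)
coprime-*ʳ {a} {b} a⊥b a⊥c {d} (d∣a , d∣bc) =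
  a⊥c (d∣a , coprime-divisor d⊥b d∣bc)
  where
  d⊥b : Coprime d b
  d⊥b (e∣d , e∣b) = a⊥b (∣-trans e∣d d∣a , e∣b)

coprime-*ˡ : Coprime a c → Coprime b c → Coprime (a * b) c
coprime-*ˡ a⊥c b⊥c = Coprime.sym (coprime-*ʳ (Coprime.sym a⊥c) (Coprime.sym b⊥c))

coprime-% : .{{_ : NonZero n}} → Coprime a n → Coprime (a % n) n
coprime-% a⊥n (d∣a%n , d∣n) = a⊥n (∣n∣m%n⇒∣m d∣n d∣a%n , d∣n)

coprime-∸ : a ≤ n → Coprime a n → Coprime (n ∸ a) n
coprime-∸ {a} {n} a≤n a⊥n (d∣n∸a , d∣n) =
  a⊥n (∣m+n∣m⇒∣n (subst (_ ∣_) (sym (m∸n+n≡m a≤n)) d∣n) d∣n∸a , d∣n)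

coprime-^ : Coprime a n → ∀ k → Coprime (a ^ k) n
coprime-^ {n = n} _ zero = Coprime.1-coprimeTo n
coprime-^ a⊥n (suc k) = coprime-*ˡ a⊥n (coprime-^ a⊥n k)

prime∤⇒coprime : Prime p → ¬ p ∣ a → Coprime a p
prime∤⇒coprime pr p∤a (d∣a , d∣p) with prime⇒irreducible pr d∣p
... | inj₁ d≡1 = d≡1
... | inj₂ refl = contradiction d∣a p∤a

prime∤⇒coprime-^ : Prime p → ¬ p ∣ a → ∀ n → Coprime a (p ^ n)
prime∤⇒coprime-^ {a = a} _ _ zero = Coprime.sym (Coprime.1-coprimeTo a)
prime∤⇒coprime-^ pr p∤a (suc n) =
  coprime-*ʳ (prime∤⇒coprime pr p∤a) (prime∤⇒coprime-^ pr p∤a n)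

coprime-^⇒∤ : Prime p → Coprime a (p ^ suc n) → ¬ p ∣ a
coprime-^⇒∤ {n = n} pr a⊥pⁿ p∣a =
  nonTrivial⇒≢1 {{prime⇒nonTrivial pr}} (a⊥pⁿ (p∣a , m∣m*n _))

module _ {q : ℕ} .{{_ : NonZero q}} where

  θ-unit : Coprime s q → IsUnit q a → IsUnit q (θ q s a)
  θ-unit s⊥q (_ , a⊥q) = m%n<n _ q , coprime-% (coprime-*ˡ s⊥q a⊥q)

  θ-* : ∀ s t a → θ q (s * t) a ≡ θ q s (θ q t a)
  θ-* s t a = trans (cong (_% q) (*-assoc s t a)) (sym ([m*[n%o]]%o≡[m*n]%o s (t * a) q))

  θ-≡ : s * x ≡ a + k * q → a < q → θ q s x ≡ a
  θ-≡ {a = a} {k = k} eq a<q =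
    trans (cong (_% q) eq) (trans ([m+kn]%n≡m%n a k q) (m<n⇒m%n≡m a<q))

  invariant-1 : Invariant q g 1
  invariant-1 {g = g} a (a<q , _) = cong g (θ-≡ {s = 1} {x = a} {k = 0} refl a<q)

  invariant-^ : Coprime s q → Invariant q g s → ∀ k → Invariant q g (s ^ k)
  invariant-^ _ _ zero = invariant-1
  invariant-^ {s} {g} s⊥q inv (suc k) a ua = begin
    g (θ q (s * s ^ k) a)     ≡⟨ cong g (θ-* s (s ^ k) a) ⟩
    g (θ q s (θ q (s ^ k) a)) ≡⟨ inv _ (θ-unit (coprime-^ s⊥q k) ua) ⟩
    g (θ q (s ^ k) a)         ≡⟨ invariant-^ s⊥q inv k a ua ⟩
    g a                       ∎
    where open ≡-Reasoning

val≡0⇒false : ∀ {b} → val b ≡ 0 → b ≡ false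
val≡0⇒false {false} _ = refl

val≡1⇒true : ∀ {b} → val b + val false ≡ 1 → b ≡ true
val≡1⇒true {true} _ = refl

module InT-facts {q : ℕ} .{{_ : NonZero q}} {g : ℕ → Bool} (T : InT q g) where
  open InT T

  small⇒false : IsUnit q a → 3 * a < q → g a ≡ false
  small⇒false {a} ua 3a<q = val≡0⇒false (small a ua 3a<q)

  large⇒true : IsUnit q a → 2 * q < 3 * a → g a ≡ true
  large⇒true {a} ua@(a<q , a⊥q) 2q<3a =
    val≡1⇒true (subst (λ b → val (g a) + val b ≡ 1) g[-a]≡false (antisym a ua))
    where
    3[q∸a]<q : 3 * (q ∸ a) < q
    3[q∸a]<q = +-cancelʳ-< (2 * q) (3 * (q ∸ a)) q (begin-strict
      3 * (q ∸ a) + 2 * q <⟨ +-monoʳ-< (3 * (q ∸ a)) 2q<3a ⟩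
      3 * (q ∸ a) + 3 * a ≡⟨ *-distribˡ-+ 3 (q ∸ a) a ⟨
      3 * (q ∸ a + a)     ≡⟨ cong (3 *_) (m∸n+n≡m (<⇒≤ a<q)) ⟩
      3 * q               ∎)
      where open ≤-Reasoning
    q∸a<q : q ∸ a < q
    q∸a<q = ≤-<-trans (m≤n*m (q ∸ a) 3) 3[q∸a]<q
    g[-a]≡false : g (negMod q a) ≡ false
    g[-a]≡false rewrite m<n⇒m%n≡m q∸a<q =
      small⇒false (q∸a<q , coprime-∸ (<⇒≤ a<q) a⊥q) 3[q∸a]<q

  ¬small↦large : Coprime s q → Invariant q g s →
                 IsUnit q x → 3 * x < q → ¬ 2 * q < 3 * θ q s x
  ¬small↦large {s} {x} s⊥q inv ux 3x<q 2q<3y with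
    trans (sym (large⇒true (θ-unit s⊥q ux) 2q<3y))
          (trans (inv x ux) (small⇒false ux 3x<q))
  ... | ()

  ¬invariant[-1] : 3 < q → ¬ Invariant q g (q ∸ 1)
  ¬invariant[-1] 3<q inv = ¬small↦large -1⊥q inv (1<q , Coprime.1-coprimeTo q) 3<q
    (subst (λ y → 2 * q < 3 * y) (sym θ[-1]1≡-1) (2*n<3*[n∸1] 3<q))
    where
    1<q : 1 < q
    1<q = <-trans (s≤s (s≤s z≤n)) 3<q
    -1⊥q : Coprime (q ∸ 1) q
    -1⊥q = coprime-∸ (<⇒≤ 1<q) (Coprime.1-coprimeTo q)
    θ[-1]1≡-1 : θ q (q ∸ 1) 1 ≡ q ∸ 1
    θ[-1]1≡-1 = θ-≡ {s = q ∸ 1} {x = 1} {k = 0}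
      (trans (*-identityʳ (q ∸ 1)) (sym (+-identityʳ (q ∸ 1))))
      (∸-monoʳ-< {q} {1} {0} z<s (<⇒≤ 1<q))

prime[3] : Prime 3
prime[3] = from-yes (prime? 3)

3∤1 : ¬ 3 ∣ 1
3∤1 (divides zero ())
3∤1 (divides (suc _) ())

3∤2 : ¬ 3 ∣ 2
3∤2 (divides zero ())
3∤2 (divides (suc _) ())

data Residue3 : ℕ → Set where
  0mod3 : ∀ a → Residue3 (a * 3)
  1mod3 : ∀ a → Residue3 (1 + a * 3)
  2mod3 : ∀ a → Residue3 (2 + a * 3)

residue3 : ∀ n → Residue3 n
residue3 0 = 0mod3 0
residue3 1 = 1mod3 0
residue3 2 = 2mod3 0
residue3 (suc (suc (suc n))) with residue3 n
... | 0mod3 a = 0mod3 (suc a)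
... | 1mod3 a = 1mod3 (suc a)
... | 2mod3 a = 2mod3 (suc a)

p-adic-split : ∀ p .{{_ : NonTrivial p}} a .{{_ : NonZero a}} →
         ∃₂ λ j t → a ≡ p ^ j * t × ¬ p ∣ t
p-adic-split p a = go a (<-wellFounded a)
  where
  go : ∀ a .{{_ : NonZero a}} → Acc _<_ a → ∃₂ λ j t → a ≡ p ^ j * t × ¬ p ∣ t
  go a (acc rec) with p ∣? a
  ... | no p∤a = 0 , a , sym (*-identityˡ a) , p∤a
  ... | yes p∣a with go (quotient p∣a) {{quotient≢0 p∣a}} (rec (quotient-< p∣a))
  ...   | j , t , k≡pʲt , p∤t = suc j , t , a≡p^[1+j]t , p∤t
    where
    a≡p^[1+j]t : a ≡ p ^ suc j * t
    a≡p^[1+j]t = begin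
      a                   ≡⟨ m∣n⇒n≡m*quotient p∣a ⟩
      p * quotient p∣a    ≡⟨ cong (p *_) k≡pʲt ⟩
      p * (p ^ j * t)     ≡⟨ *-assoc p (p ^ j) t ⟨
      p ^ suc j * t       ∎
      where open ≡-Reasoning

cube-expansion : ∀ P t → let u = 1 + 3 * P * t in
  u * (u * (u * 1)) ≡ 1 + 3 * (3 * P) * (t * (1 + (P * t + P * t * (P * t)) * 3))
cube-expansion = solve-∀

cube-lift : ¬ 3 ∣ t →
  ∃ λ t′ → (1 + 3 ^ suc j * t) ^ 3 ≡ 1 + 3 ^ suc (suc j) * t′ × ¬ 3 ∣ t′
cube-lift {t} {j} 3∤t =
    t * (1 + (v + v * v) * 3)
  , cube-expansion (3 ^ j) t
  , ∤-* prime[3] 3∤t (∣n⇒∤m+n (s≤s (s≤s z≤n)) (n∣m*n (v + v * v)))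
  where
  v = 3 ^ j * t

power-lift : ∀ i → ¬ 3 ∣ t →
  ∃ λ t′ → (1 + 3 ^ suc j * t) ^ (3 ^ i) ≡ 1 + 3 ^ (suc j + i) * t′ × ¬ 3 ∣ t′
power-lift {t} {j} zero 3∤t =
  t , trans (*-identityʳ _) (cong (λ e → 1 + 3 ^ e * t) (sym (+-identityʳ (suc j)))) , 3∤t
power-lift {t} {j} (suc i) 3∤t with power-lift {t} {j} i 3∤t
... | t₁ , eq₁ , 3∤t₁ with cube-lift {t₁} {j + i} 3∤t₁
...   | t₂ , eq₂ , 3∤t₂ = t₂ , eq , 3∤t₂
  where
  u = 1 + 3 ^ suc j * t
  eq : u ^ (3 ^ suc i) ≡ 1 + 3 ^ (suc j + suc i) * t₂
  eq = begin
    u ^ (3 * 3 ^ i)                ≡⟨ cong (u ^_) (*-comm 3 (3 ^ i)) ⟩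
    u ^ (3 ^ i * 3)                ≡⟨ ^-*-assoc u (3 ^ i) 3 ⟨
    (u ^ (3 ^ i)) ^ 3              ≡⟨ cong (_^ 3) eq₁ ⟩
    (1 + 3 ^ suc (j + i) * t₁) ^ 3 ≡⟨ eq₂ ⟩
    1 + 3 ^ suc (suc (j + i)) * t₂ ≡⟨ cong (λ e → 1 + 3 ^ suc e * t₂) (+-suc j i) ⟨
    1 + 3 ^ (suc j + suc i) * t₂   ∎
    where open ≡-Reasoning

1+x-power : ∀ {x} n → x ≡ 3 ^ suc j * t → ¬ 3 ∣ t →
  3 ^ suc n ∣ x ⊎ ∃₂ λ k t′ → (1 + x) ^ k ≡ 1 + 3 ^ n * t′ × ¬ 3 ∣ t′
1+x-power {j} {t} n refl 3∤t with suc j ≤? n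
... | no j≮n = inj₁ (∣-trans (^-monoʳ-∣ 3 (≰⇒> j≮n)) (m∣m*n t))
... | yes j<n with power-lift {t} {j} (n ∸ suc j) 3∤t
...   | t′ , eq , 3∤t′ =
  inj₂ (3 ^ (n ∸ suc j) , t′ , trans eq (cong (λ e → 1 + 3 ^ e * t′) (m+[n∸m]≡n j<n)) ,
        3∤t′)

1+3a-power : ∀ n a →
  3 ^ suc n ∣ a * 3 ⊎ ∃₂ λ k t → (1 + a * 3) ^ k ≡ 1 + 3 ^ n * t × ¬ 3 ∣ t
1+3a-power n zero = inj₁ (divides 0 refl)
1+3a-power n a@(suc _) with p-adic-split 3 a
... | j , t , a≡3ʲt , 3∤t = 1+x-power {j} n a*3≡3^[1+j]*t 3∤t
  where
  a*3≡3^[1+j]*t : a * 3 ≡ 3 ^ suc j * t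
  a*3≡3^[1+j]*t = begin
    a * 3           ≡⟨ cong (_* 3) a≡3ʲt ⟩
    3 ^ j * t * 3   ≡⟨ *-comm (3 ^ j * t) 3 ⟩
    3 * (3 ^ j * t) ≡⟨ *-assoc 3 (3 ^ j) t ⟨
    3 ^ suc j * t   ∎
    where open ≡-Reasoning

module ModPowerOf3 (n : ℕ) where
  private
    m q : ℕ
    m = 3 ^ suc n
    -- definitionally equal to 3 ^ suc (suc n)
    q = 3 * m
    instance
      q≢0 : NonZero q
      q≢0 = m^n≢0 3 (suc (suc n))

  3≤m : 3 ≤ m
  3≤m = m≤m*n 3 (3 ^ n) {{m^n≢0 3 n}}

  1<m : 1 < m
  1<m = ≤-trans (s≤s (s≤s z≤n)) 3≤m

  3<q : 3 < q
  3<q = *-monoʳ-< 3 1<m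

  3∤⇒coprime : ¬ 3 ∣ a → Coprime a q
  3∤⇒coprime 3∤a = prime∤⇒coprime-^ prime[3] 3∤a (suc (suc n))

  3∤⇒unit : ¬ 3 ∣ a → a < q → IsUnit q a
  3∤⇒unit 3∤a a<q = a<q , 3∤⇒coprime 3∤a

  [1+m*t]⊥q : Coprime (1 + m * t) q
  [1+m*t]⊥q {t} = 3∤⇒coprime (∣n⇒∤m+n (s≤s (s≤s z≤n)) (∣m⇒∣m*n t (m∣m*n (3 ^ n))))

  module _ (T : InT q g) where
    open InT-facts T

    small↦large⇒¬invariant : Coprime s q → Invariant q g s → ¬ 3 ∣ x → 3 * x < q →
                             s * x ≡ y + k * q → y < q → ¬ 2 * q < 3 * y
    small↦large⇒¬invariant {s} {x} {y} {k} s⊥q inv 3∤x 3x<q sx≡y y<q 2q<3y =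
      ¬small↦large s⊥q inv (3∤⇒unit 3∤x (≤-<-trans (m≤n*m x 3) 3x<q)) 3x<q
        (subst (λ z → 2 * q < 3 * z) (sym (θ-≡ {s = s} {x = x} {k = k} sx≡y y<q)) 2q<3y)

    ¬invariant[1+m*t] : ¬ 3 ∣ t → ¬ Invariant q g (1 + m * t)
    ¬invariant[1+m*t] {t} 3∤t inv with residue3 t
    ... | 0mod3 c = 3∤t (n∣m*n c)
    ... | 1mod3 c = small↦large⇒¬invariant {k = c * 2} [1+m*t]⊥q inv 3∤2 (*-monoʳ-< 3 3≤m)
          ([1+m[1+3c]]*2≡2+2m+2c*q m c)
          (subst (2 + m * 2 <_) (m+m*2≡3*m m) (+-monoˡ-< (m * 2) 3≤m))
          (subst (2 * q <_) (sym (3[2+2m]≡2*q+6 m)) (m<m+n (2 * q) z<s))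
      where
      [1+m[1+3c]]*2≡2+2m+2c*q : ∀ m c → (1 + m * (1 + c * 3)) * 2 ≡ 2 + m * 2 + c * 2 * (3 * m)
      [1+m[1+3c]]*2≡2+2m+2c*q = solve-∀
      3[2+2m]≡2*q+6 : ∀ m → 3 * (2 + m * 2) ≡ 2 * (3 * m) + 6
      3[2+2m]≡2*q+6 = solve-∀
    ... | 2mod3 c = small↦large⇒¬invariant {k = c} [1+m*t]⊥q inv 3∤1 3<q
          ([1+m[2+3c]]*1≡1+2m+c*q m c)
          (subst (1 + m * 2 <_) (m+m*2≡3*m m) (+-monoˡ-< (m * 2) 1<m))
          (subst (2 * q <_) (sym (3[1+2m]≡2*q+3 m)) (m<m+n (2 * q) z<s))
      where
      [1+m[2+3c]]*1≡1+2m+c*q : ∀ m c → (1 + m * (2 + c * 3)) * 1 ≡ 1 + m * 2 + c * (3 * m)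
      [1+m[2+3c]]*1≡1+2m+c*q = solve-∀
      3[1+2m]≡2*q+3 : ∀ m → 3 * (1 + m * 2) ≡ 2 * (3 * m) + 3
      3[1+2m]≡2*q+3 = solve-∀

    invariant⇒s^k≢1+m*t : Coprime s q → Invariant q g s → ¬ 3 ∣ t → ∀ k → s ^ k ≢ 1 + m * t
    invariant⇒s^k≢1+m*t s⊥q inv 3∤t k sᵏ≡1+mt =
      ¬invariant[1+m*t] 3∤t (subst (Invariant q g) sᵏ≡1+mt (invariant-^ s⊥q inv k))

    invariant⇒≡1 : IsUnit q s → Invariant q g s → s ≡ 1
    invariant⇒≡1 {s} (s<q , s⊥q) inv with residue3 s
    ... | 0mod3 c = contradiction (n∣m*n c) (coprime-^⇒∤ {n = suc n} prime[3] s⊥q)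
    ... | 1mod3 zero = refl
    ... | 1mod3 c@(suc _) with 1+3a-power (suc n) c
    ...   | inj₁ q∣3c = contradiction (∣⇒≤ q∣3c) (<⇒≱ (≤-trans (n≤1+n _) s<q))
    ...   | inj₂ (k , t , sᵏ≡1+mt , 3∤t) =
      contradiction sᵏ≡1+mt (invariant⇒s^k≢1+m*t s⊥q inv 3∤t k)
    invariant⇒≡1 {s} (s<q , s⊥q) inv | 2mod3 c
      with 1+3a-power (suc n) ((1 + c * 3) * (1 + c))
    ... | inj₁ q∣[s²-1] = contradiction (subst (Invariant q g) s≡-1 inv) (¬invariant[-1] 3<q)
      where
      q∣s+1 : q ∣ suc s
      q∣s+1 = coprime-divisor (Coprime.sym (3∤⇒coprime (∣n⇒∤m+n (s≤s (s≤s z≤n)) (n∣m*n c))))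
                (subst (q ∣_) (*-assoc (1 + c * 3) (1 + c) 3) q∣[s²-1])
      s≡-1 : s ≡ q ∸ 1
      s≡-1 = cong (_∸ 1) (≤-antisym s<q (∣⇒≤ q∣s+1))
    ... | inj₂ (k , t , [s²]ᵏ≡1+mt , 3∤t) =
      contradiction s²ᵏ≡1+mt (invariant⇒s^k≢1+m*t s⊥q inv 3∤t (2 * k))
      where
      square : ∀ c → (2 + c * 3) * ((2 + c * 3) * 1) ≡ 1 + (1 + c * 3) * (1 + c) * 3
      square = solve-∀
      s²ᵏ≡1+mt : s ^ (2 * k) ≡ 1 + m * t
      s²ᵏ≡1+mt = begin
        s ^ (2 * k)                          ≡⟨ ^-*-assoc s 2 k ⟨
        (s ^ 2) ^ k                          ≡⟨ cong (_^ k) (square c) ⟩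
        (1 + (1 + c * 3) * (1 + c) * 3) ^ k  ≡⟨ [s²]ᵏ≡1+mt ⟩
        1 + m * t                            ∎
        where open ≡-Reasoning

corollary5p15 : (r : ℕ) → 9 ≤ 3 ^ r → .{{_ : NonZero (3 ^ r)}} →
    (g : ℕ → Bool) → InT (3 ^ r) g →
    (s : ℕ) → IsUnit (3 ^ r) s →
    Invariant (3 ^ r) g s ⇔ (s ≡ 1)
corollary5p15 zero (s≤s ())
corollary5p15 (suc zero) (s≤s (s≤s (s≤s ())))
corollary5p15 (suc (suc n)) _ g T s us =
  mk⇔ invariant⇒≡1 λ { refl → invariant-1 }
  where
  -- ascribed so that Invariant carries the NonZero instance of the statement
  invariant⇒≡1 : Invariant (3 ^ suc (suc n)) g s → s ≡ 1
  invariant⇒≡1 = ModPowerOf3.invariant⇒≡1 n T us
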